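{- Let $\boldsymbol\Gamma\in\Gamma\mathsf{Dom}_0$ (with $k$ components) and let $\mathbf A\in\mathrm{Su}(\mathbb P)^k$ satisfy $\mathbf A\le\boldsymbol\Gamma(\mathbf A)$. Then $\min\boldsymbol\Gamma^{(\infty)}(\mathbf A)=\min\boldsymbol\Gamma^{(k)}(\mathbf A)$. In particular $\min\boldsymbol\Gamma^{(\infty)}(\boldsymbol\emptyset)=\min\boldsymbol\Gamma^{(k)}(\boldsymbol\emptyset)$.
   Context: $\mathbb N=\{0,1,\dots\}$, $\mathbb P=\{1,2,\dots\}$, $\mathrm{Su}(X)$ the set of subsets of $X$. For $A,B\subseteq\mathbb N$, $A+B=\{a+b\}$; $n\star B=\{0\}$ if $n=0$ and $B+\cdots+B$ ($n$ copies) if $n\ge1$. For $\mathbf u\in\mathbb N^k$, $\mathbf u\star\mathbf Y=u_1\star Y_1+\cdots+u_k\star Y_k$. $\Gamma\mathsf{Dom}$ is the set of maps $\boldsymbol\Gamma:\mathrm{Su}(\mathbb N)^k\to\mathrm{Su}(\mathbb N)^k$ of the form $\Gamma_i(\mathbf Y)=\bigcup_{\mathbf u\in\mathbb N^k}(\Gamma_{i,\mathbf u}+\mathbf u\star\mathbf Y)$ with fixed $\Gamma_{i,\mathbf u}\subseteq\mathbb N$; $\Gamma\mathsf{Dom}_0$ consists of those $\boldsymbol\Gamma\in\Gamma\mathsf{Dom}$ mapping $\mathrm{Su}(\mathbb P)^k$ into itself. $\boldsymbol\Gamma^{(n)}$ is the $n$-fold composition, and $\boldsymbol\Gamma^{(\infty)}(\mathbf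 A)=\bigcup_{n\ge0}\boldsymbol\Gamma^{(n)}(\mathbf A)$ (componentwise union). $\mathbf A\le\mathbf B$ means $A_i\subseteq B_i$ for all $i$. $\min\mathbf A=(\min A_1,\dots,\min A_k)$ with $\min\emptyset=+\infty$. $\boldsymbol\emptyset=(\emptyset,\dots,\emptyset)$. -}

module Defs where

open import Level using (0ℓ)
open import Data.Nat using (ℕ; zero; suc; _+_; _≤_)
open import Data.Fin using (Fin; zero; suc)
open import Data.Product using (Σ; ∃; _×_)
open import Data.Empty using (⊥)
open import Relation.Nullary using (¬_)
open import Relation.Binary.PropositionalEquality using (_≡_)
open import Relation.Unary using (Pred)

Su : Set₁
Su = Pred ℕ 0ℓ

Sus : ℕ → Set₁
Sus k = Fin k → Su

∅ : Su
∅ _ = ⊥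

∅s : (k : ℕ) → Sus k
∅s k _ = ∅

zeroSet : Su
zeroSet n = n ≡ 0

_⊕_ : Su → Su → Su
(A ⊕ B) x = Σ ℕ λ a → Σ ℕ λ b → A a × B b × x ≡ a + b

_⋆_ : ℕ → Su → Su
zero ⋆ B = zeroSet
suc zero ⋆ B = B
suc (suc n) ⋆ B = B ⊕ (suc n ⋆ B)

bigSum : (k : ℕ) → (Fin k → Su) → Su
bigSum zero f = zeroSet
bigSum (suc k) f = f zero ⊕ bigSum k (λ i → f (suc i))

_⋆s_ : {k : ℕ} → (Fin k → ℕ) → Sus k → Su
_⋆s_ {k} u Y = bigSum k (λ i → u i ⋆ Y i)

-- Coefficient data of a map in ΓDom: Γ_{i,u} ⊆ ℕ for i ∈ [k], u ∈ ℕ^k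
ΓData : ℕ → Set₁
ΓData k = Fin k → (Fin k → ℕ) → Su

apply : {k : ℕ} → ΓData k → Sus k → Sus k
apply {k} Γ Y i x = Σ (Fin k → ℕ) λ u → (Γ i u ⊕ (u ⋆s Y)) x

InSuP : {k : ℕ} → Sus k → Set
InSuP {k} Y = (i : Fin k) → ¬ Y i 0

IsΓDom₀ : {k : ℕ} → ΓData k → Set₁
IsΓDom₀ {k} Γ = (Y : Sus k) → InSuP Y → InSuP (apply Γ Y)

iter : {k : ℕ} → ΓData k → ℕ → Sus k → Sus k
iter Γ zero A = A
iter Γ (suc n) A = apply Γ (iter Γ n A)

iter∞ : {k : ℕ} → ΓData k → Sus k → Sus k
iter∞ Γ A i x = Σ ℕ λ n → iter Γ n A i x

_≤s_ : {k : ℕ} → Sus k → Sus k → Set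
_≤s_ {k} A B = (i : Fin k) → (x : ℕ) → A i x → B i x

data ℕ∞ : Set where
  fin : ℕ → ℕ∞
  ∞   : ℕ∞

IsMin : Su → ℕ∞ → Set
IsMin X (fin m) = X m × ((n : ℕ) → X n → m ≤ n)
IsMin X ∞ = (n : ℕ) → ¬ X n

SameMin : Su → Su → Set
SameMin X Y = (m : ℕ∞) → (IsMin X m → IsMin Y m) × (IsMin Y m → IsMin X m)

SameMins : {k : ℕ} → Sus k → Sus k → Set
SameMins {k} A B = (i : Fin k) → SameMin (A i) (B i)

-- For every n, each element x of a component of Γ⁽ⁿ⁾(A) lies above some
-- element of the same component of Γ⁽ᵏ⁾(A); the minima then agree.
-- An element of Γⱼ(Y) is a constant plus a sum of elements of Y, each at most
-- the total.  Record for every component a threshold from which it is known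
-- to be nonempty; by induction on n, every component with threshold ≤ v has an
-- element ≤ v by stage #{components with threshold ≤ v} ≤ k.  Producing x in a
-- component whose threshold was not yet ≤ x lowers that threshold to x, so the
-- count grows exactly when the stage index does.
module Submission where

open import Defs
open import Data.Nat using (ℕ; zero; suc; _+_; _≤_; _<_; _⊓_; _≤?_; _≤′_; ≤′-refl; ≤′-step; z≤n; s≤s)
open import Data.Nat.Properties
  using (≤-refl; ≤-trans; ≤-antisym; ≤⇒≤′; +-mono-≤; m≤m+n; m≤n+m; m≤n⇒m⊓o≤n; m≤n⇒o⊓m≤n; ⊓-sel)
open import Data.Fin using (Fin; zero; suc; _≟_)
open import Data.Fin.Subset using (Subset; _∈_; ∣_∣) renaming (_⊆_ to _⊆ₛ_)
open import Data.Fin.Subset.Properties using (∣p∣≤n; p⊆q⇒∣p∣≤∣q∣; p⊂q⇒∣p∣<∣q∣)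
open import Data.Vec using (tabulate)
open import Data.Vec.Properties using (lookup∘tabulate; []=⇒lookup; lookup⇒[]=)
open import Data.Product using (Σ; _×_; _,_)
open import Data.Sum using (_⊎_; inj₁; inj₂)
open import Function using (id; _∘_)
open import Relation.Nullary using (¬_; Dec; yes; no; does; contradiction)
open import Relation.Nullary.Decidable using (map′; dec-true)
open import Relation.Binary.PropositionalEquality using (_≡_; refl; sym; trans; subst)
open import Relation.Unary using (_⊆_)

private variable
  k m n : ℕ

⊕-mono : ∀ {B B′ C C′ : Su} → B ⊆ B′ → C ⊆ C′ → (B ⊕ C) ⊆ (B′ ⊕ C′)
⊕-mono f g (b , c , Bb , Cc , x≡b+c) = b , c , f Bb , g Cc , x≡b+c

⋆-mono : ∀ n {B C : Su} → B ⊆ C → (n ⋆ B) ⊆ (n ⋆ C)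
⋆-mono zero          _ = id
⋆-mono (suc zero)    f = f
⋆-mono (suc (suc n)) f = ⊕-mono f (⋆-mono (suc n) f)

bigSum-mono : ∀ m {F G : Fin m → Su} → (∀ i → F i ⊆ G i) → bigSum m F ⊆ bigSum m G
bigSum-mono zero    _ = id
bigSum-mono (suc m) f = ⊕-mono (f zero) (bigSum-mono m (f ∘ suc))

apply-mono : (Γ : ΓData k) {Y Z : Sus k} → Y ≤s Z → apply Γ Y ≤s apply Γ Z
apply-mono {k} Γ Y≤Z i x (u , p) =
  u , ⊕-mono id (bigSum-mono k (λ l → ⋆-mono (u l) (Y≤Z l _))) p

iter-mono : (Γ : ΓData k) {A : Sus k} → A ≤s apply Γ A → m ≤ n → iter Γ m A ≤s iter Γ n A
iter-mono Γ {A} A≤ΓA = chain ∘ ≤⇒≤′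
  where
  increasing : ∀ n → iter Γ n A ≤s iter Γ (suc n) A
  increasing zero    = A≤ΓA
  increasing (suc n) = apply-mono Γ (increasing n)

  chain : m ≤′ n → iter Γ m A ≤s iter Γ n A
  chain ≤′-refl            i x p = p
  chain (≤′-step {n} m≤′n) i x p = increasing n i x (chain m≤′n i x p)

infix 4 _≼_ _≼?_

data _≼_ : ℕ∞ → ℕ → Set where
  fin≤ : ∀ {w v} → w ≤ v → fin w ≼ v

_≼?_ : ∀ w v → Dec (w ≼ v)
fin w ≼? v = map′ fin≤ (λ { (fin≤ w≤v) → w≤v }) (w ≤? v)
∞     ≼? v = no λ ()

≼-weaken : ∀ {w v v′} → w ≼ v → v ≤ v′ → w ≼ v′
≼-weaken (fin≤ w≤v) v≤v′ = fin≤ (≤-trans w≤v v≤v′)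

infixl 6 _⊓∞_

_⊓∞_ : ℕ∞ → ℕ∞ → ℕ∞
fin a ⊓∞ fin b = fin (a ⊓ b)
fin a ⊓∞ ∞     = fin a
∞     ⊓∞ y     = y

⊓∞-≼ˡ : ∀ {x v} y → x ≼ v → x ⊓∞ y ≼ v
⊓∞-≼ˡ (fin b) (fin≤ a≤v) = fin≤ (m≤n⇒m⊓o≤n b a≤v)
⊓∞-≼ˡ ∞       (fin≤ a≤v) = fin≤ a≤v

⊓∞-≼ʳ : ∀ x {y v} → y ≼ v → x ⊓∞ y ≼ v
⊓∞-≼ʳ (fin a) (fin≤ b≤v) = fin≤ (m≤n⇒o⊓m≤n a b≤v)
⊓∞-≼ʳ ∞       y≼v        = y≼v

⊓∞-≼-split : ∀ x y {v} → x ⊓∞ y ≼ v → x ≼ v ⊎ y ≼ v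
⊓∞-≼-split (fin a) (fin b) (fin≤ a⊓b≤v) with ⊓-sel a b
... | inj₁ a⊓b≡a = inj₁ (fin≤ (subst (_≤ _) a⊓b≡a a⊓b≤v))
... | inj₂ a⊓b≡b = inj₂ (fin≤ (subst (_≤ _) a⊓b≡b a⊓b≤v))
⊓∞-≼-split (fin a) ∞       x≼v = inj₁ x≼v
⊓∞-≼-split ∞       y       y≼v = inj₂ y≼v

Thresholds : ℕ → Set
Thresholds k = Fin k → ℕ∞

never : Thresholds k
never _ = ∞

single : Fin k → ℕ → Thresholds k
single j y l with l ≟ j
... | yes _ = fin y
... | no  _ = ∞

single-≼-self : (j : Fin k) (y : ℕ) → single j y j ≼ y
single-≼-self j y with j ≟ j
... | yes _   = fin≤ ≤-refl
... | no  j≢j = contradiction refl j≢j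

single-≼ : ∀ {j l : Fin k} {y v} → single j y l ≼ v → l ≡ j × y ≤ v
single-≼ {j = j} {l} with l ≟ j
... | yes l≡j = λ { (fin≤ y≤v) → l≡j , y≤v }
... | no  _   = λ ()

infixl 6 _⊓ᵗ_

_⊓ᵗ_ : Thresholds k → Thresholds k → Thresholds k
(s ⊓ᵗ t) l = s l ⊓∞ t l

⊓ᵗ-≼ˡ : ∀ (s t : Thresholds k) {v w} → v ≤ w → ∀ l → s l ≼ v → (s ⊓ᵗ t) l ≼ w
⊓ᵗ-≼ˡ s t v≤w l sl≼v = ⊓∞-≼ˡ (t l) (≼-weaken sl≼v v≤w)

⊓ᵗ-≼ʳ : ∀ (s t : Thresholds k) {v w} → v ≤ w → ∀ l → t l ≼ v → (s ⊓ᵗ t) l ≼ w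
⊓ᵗ-≼ʳ s t v≤w l tl≼v = ⊓∞-≼ʳ (s l) (≼-weaken tl≼v v≤w)

reached : Thresholds k → ℕ → Subset k
reached t v = tabulate (λ l → does (t l ≼? v))

∈-reached⁺ : ∀ {t : Thresholds k} {l v} → t l ≼ v → l ∈ reached t v
∈-reached⁺ {t = t} {l} {v} tl≼v =
  lookup⇒[]= l _ (trans (lookup∘tabulate _ l) (dec-true (t l ≼? v) tl≼v))

∈-reached⁻ : ∀ {t : Thresholds k} {l v} → l ∈ reached t v → t l ≼ v
∈-reached⁻ {t = t} {l} {v} l∈ with t l ≼? v | trans (sym (lookup∘tabulate _ l)) ([]=⇒lookup l∈)
... | yes tl≼v | _ = tl≼v
... | no  _    | ()

stage : Thresholds k → ℕ → ℕ
stage t v = ∣ reached t v ∣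

stage≤ : (t : Thresholds k) (v : ℕ) → stage t v ≤ k
stage≤ t v = ∣p∣≤n (reached t v)

reached-⊆ : ∀ {s t : Thresholds k} {v w} → (∀ l → s l ≼ v → t l ≼ w) → reached s v ⊆ₛ reached t w
reached-⊆ {s = s} {t} s⇒t l∈ = ∈-reached⁺ {t = t} (s⇒t _ (∈-reached⁻ {t = s} l∈))

stage-mono : ∀ {s t : Thresholds k} {v w} → (∀ l → s l ≼ v → t l ≼ w) → stage s v ≤ stage t w
stage-mono s⇒t = p⊆q⇒∣p∣≤∣q∣ (reached-⊆ s⇒t)

stage-mono-strict : ∀ {s t : Thresholds k} {v w} (j : Fin k) → (∀ l → s l ≼ v → t l ≼ w) →
  ¬ s j ≼ v → t j ≼ w → stage s v < stage t w
stage-mono-strict {s = s} {t} j s⇒t sj⋠v tj≼w =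
  p⊂q⇒∣p∣<∣q∣ (reached-⊆ s⇒t , j , ∈-reached⁺ {t = t} tj≼w , sj⋠v ∘ ∈-reached⁻ {t = s})

Below : Su → ℕ → Set
Below B v = Σ ℕ λ y → y ≤ v × B y

Below-mono : ∀ {B C : Su} {v} → B ⊆ C → Below B v → Below C v
Below-mono B⊆C (y , y≤v , By) = y , y≤v , B⊆C By

Below-weaken : ∀ {B : Su} {v w} → v ≤ w → Below B v → Below B w
Below-weaken v≤w (y , y≤v , By) = y , ≤-trans y≤v v≤w , By

Minorizes : Su → Su → Set
Minorizes B C = ∀ {x} → C x → Below B x

sameMin-minorized : ∀ {B C : Su} → B ⊆ C → Minorizes B C → SameMin C B
sameMin-minorized {B} {C} B⊆C B≼C (fin m) = C→B , B→C
  where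
  C→B : IsMin C (fin m) → IsMin B (fin m)
  C→B (Cm , m≤C) with B≼C Cm
  ... | y , y≤m , By = subst B (≤-antisym y≤m (m≤C y (B⊆C By))) By , λ z Bz → m≤C z (B⊆C Bz)

  B→C : IsMin B (fin m) → IsMin C (fin m)
  B→C (Bm , m≤B) = B⊆C Bm , λ z Cz → let (y , y≤z , By) = B≼C Cz in ≤-trans (m≤B y By) y≤z
sameMin-minorized B⊆C B≼C ∞ =
  (λ C-empty z Bz → C-empty z (B⊆C Bz)) ,
  (λ B-empty z Cz → let (y , _ , By) = B≼C Cz in B-empty y By)

Monotone : (ℕ → Su) → Set
Monotone F = ∀ {m n} → m ≤ n → F m ⊆ F n

module _ {k} (Γ : ΓData k) {A : Sus k} (A≤ΓA : A ≤s apply Γ A) where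

  private
    X : ℕ → Sus k
    X n = iter Γ n A

    X-mono : m ≤ n → X m ≤s X n
    X-mono = iter-mono Γ A≤ΓA

    Below-X-mono : ∀ {l v} → m ≤ n → Below (X m l) v → Below (X n l) v
    Below-X-mono m≤n = Below-mono (X-mono m≤n _ _)

  Valid : Thresholds k → Set
  Valid t = ∀ l v → t l ≼ v → Below (X (stage t v) l) v

  valid-never : Valid never
  valid-never l v ()

  valid-⊓ : ∀ {s t} → Valid s → Valid t → Valid (s ⊓ᵗ t)
  valid-⊓ {s} {t} valid-s valid-t l v s⊓t≼v with ⊓∞-≼-split (s l) (t l) s⊓t≼v
  ... | inj₁ sl≼v = Below-X-mono (stage-mono (⊓ᵗ-≼ˡ s t ≤-refl)) (valid-s l v sl≼v)
  ... | inj₂ tl≼v = Below-X-mono (stage-mono (⊓ᵗ-≼ʳ s t ≤-refl)) (valid-t l v tl≼v)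

  valid-⊓-single : ∀ {t j x} → Valid t → Below (X (suc (stage t x)) j) x → Valid (t ⊓ᵗ single j x)
  valid-⊓-single {t} {j} {x} valid-t new l v t′l≼v with ⊓∞-≼-split (t l) (single j x l) t′l≼v
  ... | inj₁ tl≼v = Below-X-mono (stage-mono (⊓ᵗ-≼ˡ t (single j x) ≤-refl)) (valid-t l v tl≼v)
  ... | inj₂ jx≼v with single-≼ jx≼v
  ... | refl , x≤v with t j ≼? x
  ...   | yes tj≼x =
    Below-weaken x≤v (Below-X-mono (stage-mono (⊓ᵗ-≼ˡ t (single j x) x≤v)) (valid-t j x tj≼x))
  ...   | no  tj⋠x =  -- j is newly reached at x, so the stage has grown by one
    Below-weaken x≤v (Below-X-mono (stage-mono-strict j (⊓ᵗ-≼ˡ t (single j x) x≤v) tj⋠x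
                                      (⊓ᵗ-≼ʳ t (single j x) x≤v j (single-≼-self j x))) new)

  Reducible : ℕ → (ℕ → Su) → Set
  Reducible n F = ∀ {s} → F n s → Σ (Thresholds k) λ t → Valid t × Below (F (stage t s)) s

  reducible-const : ∀ {n} (C : Su) → Reducible n (λ _ → C)
  reducible-const C {s} Cs = never , valid-never , s , ≤-refl , Cs

  reducible-⊕ : ∀ {n F G} → Monotone F → Monotone G → Reducible n F → Reducible n G →
    Reducible n (λ m → F m ⊕ G m)
  reducible-⊕ F-mono G-mono F-red G-red (a , c , Fa , Gc , refl)
    with F-red Fa | G-red Gc
  ... | t₁ , valid-t₁ , a′ , a′≤a , Fa′ | t₂ , valid-t₂ , c′ , c′≤c , Gc′ =
    t₁ ⊓ᵗ t₂ , valid-⊓ valid-t₁ valid-t₂ , a′ + c′ , +-mono-≤ a′≤a c′≤c ,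
    ( a′ , c′
    , F-mono (stage-mono (⊓ᵗ-≼ˡ t₁ t₂ (m≤m+n a c))) Fa′
    , G-mono (stage-mono (⊓ᵗ-≼ʳ t₁ t₂ (m≤n+m c a))) Gc′
    , refl )

  reducible-⋆ : ∀ {n F} c → Monotone F → Reducible n F → Reducible n (λ m → c ⋆ F m)
  reducible-⋆ {n} zero          F-mono F-red = reducible-const {n} zeroSet
  reducible-⋆     (suc zero)    F-mono F-red = F-red
  reducible-⋆     (suc (suc c)) F-mono F-red =
    reducible-⊕ F-mono (⋆-mono (suc c) ∘ F-mono) F-red (reducible-⋆ (suc c) F-mono F-red)

  reducible-bigSum : ∀ {n} m′ {F : Fin m′ → ℕ → Su} → (∀ i → Monotone (F i)) → (∀ i → Reducible n (F i)) →
    Reducible n (λ m → bigSum m′ (λ i → F i m))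
  reducible-bigSum {n} zero     F-mono F-red = reducible-const {n} zeroSet
  reducible-bigSum     (suc m′) F-mono F-red =
    reducible-⊕ (F-mono zero) (λ m≤n → bigSum-mono m′ (λ i → F-mono (suc i) m≤n))
      (F-red zero) (reducible-bigSum m′ (F-mono ∘ suc) (F-red ∘ suc))

  component-mono : ∀ l → Monotone (λ m → X m l)
  component-mono l m≤n = X-mono m≤n l _

  Certified : ℕ → Set
  Certified n = ∀ j {x} → X n j x → Σ (Thresholds k) λ t → Valid t × t j ≼ x

  reducible-component : ∀ {n} l → Certified n → Reducible n (λ m → X m l)
  reducible-component l certified-n {x} Xx with certified-n l Xx
  ... | t , valid-t , tl≼x = t , valid-t , valid-t l x tl≼x

  reducible-summand : ∀ {n} i u → Certified n → Reducible n (λ m → Γ i u ⊕ (u ⋆s X m))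
  reducible-summand {n} i u certified-n =
    reducible-⊕ {n} (λ _ → id) (λ m≤n → bigSum-mono k (λ l → ⋆-mono (u l) (component-mono l m≤n)))
      (reducible-const {n} (Γ i u))
      (reducible-bigSum {n} k (λ l → ⋆-mono (u l) ∘ component-mono l)
        (λ l → reducible-⋆ {n} (u l) (component-mono l) (reducible-component {n} l certified-n)))

  certify : ∀ {t j x} → Valid t → Below (X (suc (stage t x)) j) x →
    Σ (Thresholds k) λ t′ → Valid t′ × t′ j ≼ x
  certify {t} {j} {x} valid-t new =
    t ⊓ᵗ single j x , valid-⊓-single valid-t new , ⊓ᵗ-≼ʳ t (single j x) ≤-refl j (single-≼-self j x)

  certified : ∀ n → Certified n
  certified zero    j {x} Ax =
    certify valid-never (x , ≤-refl , X-mono {n = suc (stage {k} never x)} (s≤s z≤n) j x (A≤ΓA j x Ax))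
  certified (suc n) j {x} (u , p) with reducible-summand {n} j u (certified n) p
  ... | t , valid-t , x′ , x′≤x , q = certify valid-t (x′ , x′≤x , (u , q))

  minorized : ∀ n i → Minorizes (X k i) (X n i)
  minorized n i {x} Xx with certified n i Xx
  ... | t , valid-t , ti≼x = Below-X-mono (stage≤ t x) (valid-t i x ti≼x)

  iter∞-sameMins : SameMins (iter∞ Γ A) (iter Γ k A)
  iter∞-sameMins i = sameMin-minorized (λ Xk → k , Xk) (λ (n , Xn) → minorized n i Xn)

lemma3p4 : (k : ℕ) (Γ : ΓData k) → IsΓDom₀ Γ →
    ((A : Sus k) → InSuP A → A ≤s apply Γ A →
      SameMins (iter∞ Γ A) (iter Γ k A))
    × SameMins (iter∞ Γ (∅s k)) (iter Γ k (∅s k))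
lemma3p4 k Γ _ = (λ A _ → iter∞-sameMins Γ) , iter∞-sameMins Γ (λ _ _ ())
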